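{- Let $n>3$ and let $f$ be an automorphism of $\Pi(n,\zeta_n,\mathbf G_2(I_n))$. Then $f=\mathrm{id}$.
   Context: $I_n=\{1,\dots,n\}$, $\wp_k(X)$ the $k$-subsets of $X$. $\mathbf G_2(I_n)$ is the configuration with point set $\wp_2(I_n)$ and lines $\wp_2(Y)$, $Y\in\wp_3(I_n)$. $\zeta_n(\{i,j\})=\{j-i,j\}$ for $1\le i<j\le n$. $\Pi(n,\sigma,\mathfrak N)$ has pairwise distinct points $a_i,b_i$ ($i\in I_n$), $p$, $c_u$ ($u\in\wp_2(I_n)$) and lines $\{p,a_i,b_i\}$, $\{a_i,a_j,c_{\{i,j\}}\}$, $\{b_i,b_j,c_{\sigma^{ -1}(\{i,j\})}\}$, and $\{c_u,c_v,c_w\}$ for every line $\{u,v,w\}$ of $\mathfrak N$. An automorphism is a permutation of the points mapping lines onto lines. -}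

module Defs where

open import Data.Nat using (ℕ; suc; _∸_)
open import Data.Fin using (Fin; toℕ; _<_)
open import Data.Product using (_×_)
open import Data.Sum using (_⊎_)
open import Relation.Binary.PropositionalEquality using (_≡_)
open import Function.Definitions using (Bijective)

-- I_n = {1,…,n} is represented by Fin n; element i : Fin n stands for the
-- number ι i = toℕ i + 1.
ι : {n : ℕ} → Fin n → ℕ
ι i = suc (toℕ i)

-- A 2-subset {i,j} of I_n is written as an ordered pair (i , j) with i < j.
-- Graph of ζ_n : ζ_n({i,j}) = {j-i, j} for i < j; the image {j-i,j}
-- is written in increasing order (k , l) with k = j - i < l = j.
ZetaGraph : {n : ℕ} → (i j k l : Fin n) → Set
ZetaGraph i j k l = (ι k ≡ ι j ∸ ι i) × (l ≡ j)

data Pt (n : ℕ) : Set where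
  p : Pt n
  a : Fin n → Pt n
  b : Fin n → Pt n
  c : (i j : Fin n) → i < j → Pt n

-- Generating lines, each listed in one order.
data BaseLine {n : ℕ} : Pt n → Pt n → Pt n → Set where
  pab : (i : Fin n) → BaseLine p (a i) (b i)
  aac : (i j : Fin n) (h : i < j) → BaseLine (a i) (a j) (c i j h)
  -- {b_k, b_l, c_{σ⁻¹{k,l}}} with σ = ζ_n, i.e. c_u where ζ_n(u) = {k,l}
  bbc : (i j k l : Fin n) (h : i < j) (h' : k < l) →
        ZetaGraph i j k l → BaseLine (b k) (b l) (c i j h)
  -- {c_u, c_v, c_w} for the line {u,v,w} = ℘₂({x,y,z}) of G_2(I_n)
  ccc : (x y z : Fin n) (h₁ : x < y) (h₂ : y < z) (h₃ : x < z) →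
        BaseLine (c x y h₁) (c x z h₃) (c y z h₂)

IsLine : {n : ℕ} → Pt n → Pt n → Pt n → Set
IsLine x y z =
  BaseLine x y z ⊎ BaseLine x z y ⊎ BaseLine y x z ⊎
  BaseLine y z x ⊎ BaseLine z x y ⊎ BaseLine z y x

IsAutomorphism : {n : ℕ} → (Pt n → Pt n) → Set
IsAutomorphism {n} f =
  Bijective {A = Pt n} _≡_ _≡_ f ×
  ((x y z : Pt n) → IsLine x y z → IsLine (f x) (f y) (f z))

{-# OPTIONS --safe #-}

-- Call x the centre of a tripod if three lines {x, yᵢ, zᵢ} pass through x and any two of them
-- extend to a complete quadrilateral: yᵢ, yⱼ, w and zᵢ, zⱼ, w are lines for some w ≠ x.  An
-- injective line-preserving map sends tripod centres to tripod centres.  Every a- and c-point is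
-- a centre (this uses n ≥ 4); p is not, since that would need three indices pairwise in ratio 2;
-- and no b k is, since two lines through b k with partners j, l can only be completed when
-- {j, l, k} = {t, 2t, 3t}, which three lines cannot satisfy simultaneously.
--
-- Hence the preimage of p is p or some b i.  If f(b i) = p, then f(p) = b k and the lines
-- through b i are sent to lines through p, so f maps the c-points on them to a-points and the
-- a-points a x (x ≠ i) to c-points; a line a x, a l, c then becomes a line with two c-points and
-- one a-point, unless i = n, where the pairs {1, n} and {2, n} give a contradiction instead.
-- So f p = p, f(a i) = a (φ i) and f(b i) = b (φ i) for a permutation φ commuting with ζ.  Such
-- a φ preserves the order of i < j unless j = 2i, which forces φ = id.

module Submission where

open import Defs
open import Data.Nat using (ℕ; _<_)
open import Relation.Binary.PropositionalEquality using (_≡_)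

open import Data.Empty using (⊥; ⊥-elim)
open import Data.Fin as Fin using (Fin; toℕ; fromℕ<)
import Data.Fin.Properties as Finₚ
open import Data.List using (List; []; _∷_; length; lookup)
open import Data.List.Membership.Propositional using (_∈_; _∉_)
open import Data.List.Relation.Unary.Any using (here; there; index; any?)
open import Data.List.Relation.Unary.Any.Properties using (lookup-index)
open import Data.Maybe using (Maybe; just; nothing)
open import Data.Nat as ℕ using (zero; suc; _+_; _*_; _∸_; z≤n; s≤s)
import Data.Nat.Properties as ℕₚ
open import Data.Nat.Tactic.RingSolver using (solve)
open import Data.Product using (Σ; ∃; ∃-syntax; _×_; _,_; proj₁; proj₂; swap)
open import Data.Sum using (_⊎_; inj₁; inj₂; [_,_])
open import Function using (_∘_)
open import Function.Definitions using (Injective; Surjective)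
open import Relation.Binary using (tri<; tri≈; tri>)
open import Relation.Binary.PropositionalEquality
  using (_≢_; ≢-sym; refl; sym; trans; cong; cong₂; subst; subst₂; module ≡-Reasoning)
open import Relation.Nullary using (¬_; contradiction)

-- The six disjuncts of IsLine x y z, named by the order of x, y, z in the BaseLine.
pattern xyz l = inj₁ l
pattern xzy l = inj₂ (inj₁ l)
pattern yxz l = inj₂ (inj₂ (inj₁ l))
pattern yzx l = inj₂ (inj₂ (inj₂ (inj₁ l)))
pattern zxy l = inj₂ (inj₂ (inj₂ (inj₂ (inj₁ l))))
pattern zyx l = inj₂ (inj₂ (inj₂ (inj₂ (inj₂ l))))

module _ {n : ℕ} {x y z : Pt n} where

  IsLine-swap₁₂ : IsLine x y z → IsLine y x z
  IsLine-swap₁₂ (xyz l) = yxz l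
  IsLine-swap₁₂ (xzy l) = yzx l
  IsLine-swap₁₂ (yxz l) = xyz l
  IsLine-swap₁₂ (yzx l) = xzy l
  IsLine-swap₁₂ (zxy l) = zyx l
  IsLine-swap₁₂ (zyx l) = zxy l

  IsLine-swap₂₃ : IsLine x y z → IsLine x z y
  IsLine-swap₂₃ (xyz l) = xzy l
  IsLine-swap₂₃ (xzy l) = xyz l
  IsLine-swap₂₃ (yxz l) = zxy l
  IsLine-swap₂₃ (yzx l) = zyx l
  IsLine-swap₂₃ (zxy l) = yxz l
  IsLine-swap₂₃ (zyx l) = yzx l

IsLine-rotate : ∀ {n} {x y z : Pt n} → IsLine x y z → IsLine y z x
IsLine-rotate = IsLine-swap₂₃ ∘ IsLine-swap₁₂

-- Unordered pairs

module _ {A : Set} where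

  _∈₂_ : A → A × A → Set
  e ∈₂ (u , v) = e ≡ u ⊎ e ≡ v

  _∉₂_ : A → A × A → Set
  e ∉₂ uv = ¬ e ∈₂ uv

  _≈₂_ : A × A → A × A → Set
  (u , v) ≈₂ (s , t) = (u ≡ s × v ≡ t) ⊎ (u ≡ t × v ≡ s)

  ≈₂-sym : ∀ {u v s t : A} → (u , v) ≈₂ (s , t) → (s , t) ≈₂ (u , v)
  ≈₂-sym (inj₁ (refl , refl)) = inj₁ (refl , refl)
  ≈₂-sym (inj₂ (refl , refl)) = inj₂ (refl , refl)

  ≈₂-swap : ∀ {u v s t : A} → (u , v) ≈₂ (s , t) → (u , v) ≈₂ (t , s)
  ≈₂-swap (inj₁ (refl , refl)) = inj₂ (refl , refl)
  ≈₂-swap (inj₂ (refl , refl)) = inj₁ (refl , refl)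

  ∈₂-resp-≈₂ : ∀ {e u v s t : A} → (u , v) ≈₂ (s , t) → e ∈₂ (u , v) → e ∈₂ (s , t)
  ∈₂-resp-≈₂ (inj₁ (refl , refl)) e∈ = e∈
  ∈₂-resp-≈₂ (inj₂ (refl , refl)) (inj₁ e≡u) = inj₂ e≡u
  ∈₂-resp-≈₂ (inj₂ (refl , refl)) (inj₂ e≡v) = inj₁ e≡v

  ≈₂-diagonal : ∀ {u v s : A} → (u , v) ≈₂ (s , s) → u ≡ v
  ≈₂-diagonal (inj₁ (refl , refl)) = refl
  ≈₂-diagonal (inj₂ (refl , refl)) = refl

-- Arithmetic and counting

fresh : ∀ {n} (xs : List (Fin n)) → length xs ℕ.< n → ∃[ w ] w ∉ xs
fresh {n} xs len<n = Finₚ.¬∀⟶∃¬ n (_∈ xs) (λ w → any? (w Finₚ.≟_) xs) not-all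
  where
    not-all : ¬ (∀ w → w ∈ xs)
    not-all all∈ with i , j , i<j , same ← Finₚ.pigeonhole len<n (index ∘ all∈) =
      Finₚ.<⇒≢ i<j (trans (lookup-index (all∈ i))
                      (trans (cong (lookup xs) same) (sym (lookup-index (all∈ j)))))

halve : ∀ {m n} → m + m ≡ n + n → m ≡ n
halve {zero}  {zero}  _ = refl
halve {suc m} {suc n} e = cong suc (halve (ℕₚ.suc-injective
  (trans (sym (ℕₚ.+-suc m m)) (trans (ℕₚ.suc-injective e) (ℕₚ.+-suc n n)))))

progression : ∀ {j l k x} → j + l ≡ k → l + x ≡ k → j + x ≡ l → 3 * j ≡ k × 3 * l ≡ 2 * k
progression {j} {l} {k} {x} j+l≡k l+x≡k j+x≡l = 3j≡k , 3l≡2k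
  where
    open ≡-Reasoning
    x≡j : x ≡ j
    x≡j = ℕₚ.+-cancelˡ-≡ l x j (trans l+x≡k (trans (sym j+l≡k) (ℕₚ.+-comm j l)))
    2j≡l : j + j ≡ l
    2j≡l = subst (λ y → j + y ≡ l) x≡j j+x≡l
    3j≡k : 3 * j ≡ k
    3j≡k = begin
      3 * j        ≡⟨ solve (j ∷ []) ⟩
      j + (j + j)  ≡⟨ cong (j +_) 2j≡l ⟩
      j + l        ≡⟨ j+l≡k ⟩
      k            ∎
    3l≡2k : 3 * l ≡ 2 * k
    3l≡2k = begin
      3 * l        ≡⟨ cong (3 *_) (sym 2j≡l) ⟩
      3 * (j + j)  ≡⟨ solve (j ∷ []) ⟩
      2 * (3 * j)  ≡⟨ cong (2 *_) 3j≡k ⟩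
      2 * k        ∎

two-below : ∀ {x y z} → x ≢ y → x ℕ.< z → y ℕ.< z → 2 ℕ.≤ z
two-below {z = suc (suc _)} _ _ _ = s≤s (s≤s z≤n)
two-below {zero} {zero} {suc zero} x≢y _ _ = ⊥-elim (x≢y refl)
two-below {suc _} {_} {suc zero} _ (s≤s ()) _
two-below {zero} {suc _} {suc zero} _ _ (s≤s ())

thrice≡twice⇒0 : ∀ x → 3 * x ≡ x + x → x ≡ 0
thrice≡twice⇒0 x e =
  sym (ℕₚ.+-cancelˡ-≡ (x + x) 0 x (trans (ℕₚ.+-identityʳ (x + x)) (trans (sym e) (solve (x ∷ [])))))

thrice≡quadruple⇒0 : ∀ x → 3 * x ≡ 2 * (x + x) → x ≡ 0
thrice≡quadruple⇒0 x e =
  sym (ℕₚ.+-cancelˡ-≡ (3 * x) 0 x (trans (ℕₚ.+-identityʳ (3 * x)) (trans e (solve (x ∷ [])))))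

-- ζ, doubling and thirds

module _ {n : ℕ} where

  ι-injective : {i j : Fin n} → ι i ≡ ι j → i ≡ j
  ι-injective = Finₚ.toℕ-injective ∘ ℕₚ.suc-injective

  ι-mono : {i j : Fin n} → i Fin.< j → ι i ℕ.≤ ι j
  ι-mono = ℕₚ.m≤n⇒m≤1+n

  ι+ι≢ι : (i j : Fin n) → ι i + ι j ≢ ι i
  ι+ι≢ι i j = ℕₚ.m+1+n≢m (ι i)

  <⊎> : {i j : Fin n} → i ≢ j → i Fin.< j ⊎ j Fin.< i
  <⊎> {i} {j} i≢j with Finₚ.<-cmp i j
  ... | tri< i<j _ _ = inj₁ i<j
  ... | tri≈ _ i≡j _ = ⊥-elim (i≢j i≡j)
  ... | tri> _ _ j<i = inj₂ j<i

  succ≢double : {i j : Fin n} → toℕ j ≡ suc (toℕ i) → 0 ℕ.< toℕ i → ι j ≢ ι i + ι i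
  succ≢double {i} j≡i+1 0<i j≡2i =
    ℕₚ.<⇒≢ 0<i (ℕₚ.suc-injective
      (ℕₚ.+-cancelʳ-≡ (ι i) 1 (ι i) (trans (cong suc (sym j≡i+1)) j≡2i)))

  difference-unique : {s t x y : Fin n} → ι s + ι x ≡ ι y → ι t + ι x ≡ ι y → s ≡ t
  difference-unique e e′ = ι-injective (ℕₚ.+-cancelʳ-≡ _ _ _ (trans e (sym e′)))

  data ZetaImage (x y s t : Fin n) : Set where
    ordered : ZetaGraph x y s t → ZetaImage x y s t
    swapped : ZetaGraph x y t s → ZetaImage x y s t

  zetaImage-sym : ∀ {x y s t} → ZetaImage x y s t → ZetaImage x y t s
  zetaImage-sym (ordered g) = swapped g
  zetaImage-sym (swapped g) = ordered g

  zetaImage-max : ∀ {x y s t} → ZetaImage x y s t → y ∈₂ (s , t)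
  zetaImage-max (ordered (_ , t≡y)) = inj₂ (sym t≡y)
  zetaImage-max (swapped (_ , s≡y)) = inj₁ (sym s≡y)

  zetaGraph-sum : ∀ {x y s t} → x Fin.< y → ZetaGraph x y s t → ι s + ι x ≡ ι y × t ≡ y
  zetaGraph-sum {x} x<y (s≡y∸x , t≡y) =
    trans (cong (_+ ι x) s≡y∸x) (ℕₚ.m∸n+n≡m (ι-mono x<y)) , t≡y

  zetaImage-sum : ∀ {x y s t} → x Fin.< y → ZetaImage x y s t →
                  (ι s + ι x ≡ ι y × t ≡ y) ⊎ (ι t + ι x ≡ ι y × s ≡ y)
  zetaImage-sum x<y (ordered g) = inj₁ (zetaGraph-sum x<y g)
  zetaImage-sum x<y (swapped g) = inj₂ (zetaGraph-sum x<y g)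

  zetaImage-sum-< : {x y s t : Fin n} → x Fin.< y → ZetaImage x y s t → s Fin.< t →
                    ι s + ι x ≡ ι y × t ≡ y
  zetaImage-sum-< {x} {t = t} x<y ζ s<t with zetaImage-sum x<y ζ
  ... | inj₁ sum = sum
  ... | inj₂ (t+x≡s , refl) =
    ⊥-elim (ℕₚ.<-asym s<t (ℕₚ.≤-pred (subst (ι t ℕ.<_) t+x≡s (ℕₚ.m<m+n (ι t) (s≤s z≤n)))))

  zetaImage-irrefl : ∀ {x y s} → x Fin.< y → ¬ ZetaImage x y s s
  zetaImage-irrefl {x} x<y ζ with zetaImage-sum x<y ζ
  ... | inj₁ (sum , refl) = ι+ι≢ι _ x sum
  ... | inj₂ (sum , refl) = ι+ι≢ι _ x sum

  zetaImage-functional : ∀ {x y s t s′ t′} → x Fin.< y →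
    ZetaImage x y s t → ZetaImage x y s′ t′ → (s , t) ≈₂ (s′ , t′)
  zetaImage-functional x<y ζ ζ′ with zetaImage-sum x<y ζ | zetaImage-sum x<y ζ′
  ... | inj₁ (e , refl) | inj₁ (e′ , refl) = inj₁ (difference-unique e e′ , refl)
  ... | inj₁ (e , refl) | inj₂ (e′ , refl) = inj₂ (difference-unique e e′ , refl)
  ... | inj₂ (e , refl) | inj₁ (e′ , refl) = inj₂ (refl , difference-unique e e′)
  ... | inj₂ (e , refl) | inj₂ (e′ , refl) = inj₁ (refl , difference-unique e e′)

  Doubles : Fin n → Fin n → Set
  Doubles u v = ι v ≡ ι u + ι u

  Doubling : Fin n → Fin n → Set
  Doubling u v = Doubles u v ⊎ Doubles v u

  doubling-sym : {s t : Fin n} → Doubling s t → Doubling t s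
  doubling-sym (inj₁ d) = inj₂ d
  doubling-sym (inj₂ d) = inj₁ d

  doubles⇒< : {u v : Fin n} → Doubles u v → ι u ℕ.< ι v
  doubles⇒< {u} v≡2u = subst (ι u ℕ.<_) (sym v≡2u) (ℕₚ.m<m+n (ι u) (s≤s z≤n))

  zetaImage-fixed⇒doubling : {x y s t : Fin n} → x Fin.< y → ZetaImage x y s t →
                             (x , y) ≈₂ (s , t) → Doubling s t
  zetaImage-fixed⇒doubling x<y ζ x,y≈s,t with zetaImage-sum x<y ζ | x,y≈s,t
  ... | inj₁ (e , refl) | inj₁ (refl , refl) = inj₁ (sym e)
  ... | inj₁ (e , refl) | inj₂ (refl , refl) = ⊥-elim (Finₚ.<⇒≢ x<y refl)
  ... | inj₂ (e , refl) | inj₁ (refl , refl) = ⊥-elim (Finₚ.<⇒≢ x<y refl)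
  ... | inj₂ (e , refl) | inj₂ (refl , refl) = inj₂ (sym e)

  no-doubling-triangle : {s t u : Fin n} → s ≢ t → s ≢ u → t ≢ u →
                         Doubling s t → Doubling s u → Doubling t u → ⊥
  no-doubling-triangle _ _ t≢u (inj₁ t≡2s) (inj₁ u≡2s) _ =
    t≢u (ι-injective (trans t≡2s (sym u≡2s)))
  no-doubling-triangle _ _ t≢u (inj₂ s≡2t) (inj₂ s≡2u) _ =
    t≢u (ι-injective (halve (trans (sym s≡2t) s≡2u)))
  no-doubling-triangle _ _ _ (inj₁ t≡2s) (inj₂ s≡2u) (inj₁ u≡2t) =
    ℕₚ.<-asym (ℕₚ.<-trans (doubles⇒< s≡2u) (doubles⇒< t≡2s)) (doubles⇒< u≡2t)
  no-doubling-triangle _ _ _ (inj₂ s≡2t) (inj₁ u≡2s) (inj₂ t≡2u) =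
    ℕₚ.<-asym (ℕₚ.<-trans (doubles⇒< s≡2t) (doubles⇒< u≡2s)) (doubles⇒< t≡2u)
  no-doubling-triangle _ s≢u _ (inj₁ t≡2s) (inj₂ s≡2u) (inj₂ t≡2u) =
    s≢u (ι-injective (halve (trans (sym t≡2s) t≡2u)))
  no-doubling-triangle s≢t _ _ (inj₂ s≡2t) (inj₁ u≡2s) (inj₁ u≡2t) =
    s≢t (ι-injective (halve (trans (sym u≡2s) u≡2t)))

  Third : Fin n → Fin n → Set
  Third t m = 3 * ι t ≡ ι m ⊎ 3 * ι t ≡ 2 * ι m

  third⇒< : {t m : Fin n} → Third t m → t Fin.< m
  third⇒< {t} (inj₁ 3t≡m) = ℕₚ.≤-pred (subst (ι t ℕ.<_) 3t≡m (ℕₚ.m<m+n (ι t) (s≤s z≤n)))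
  third⇒< {t} {m} (inj₂ 3t≡2m) =
    ℕₚ.≤-pred (ℕₚ.*-cancelˡ-< 2 (ι t) (ι m)
      (subst (2 * ι t ℕ.<_) 3t≡2m (ℕₚ.*-monoˡ-< (ι t) (ℕₚ.n<1+n 2))))

  ¬three-thirds : {t₁ t₂ t₃ m : Fin n} → t₁ ≢ t₂ → t₁ ≢ t₃ → t₂ ≢ t₃ →
                  Third t₁ m → Third t₂ m → Third t₃ m → ⊥
  ¬three-thirds t₁≢t₂ t₁≢t₃ t₂≢t₃ = go
    where
      same : ∀ {t t′ : Fin n} {v} → 3 * ι t ≡ v → 3 * ι t′ ≡ v → t ≡ t′
      same e e′ = ι-injective (ℕₚ.*-cancelˡ-≡ _ _ 3 (trans e (sym e′)))
      go : _ → _ → _ → ⊥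
      go (inj₁ e₁) (inj₁ e₂) _         = t₁≢t₂ (same e₁ e₂)
      go (inj₂ e₁) (inj₂ e₂) _         = t₁≢t₂ (same e₁ e₂)
      go (inj₁ e₁) (inj₂ e₂) (inj₁ e₃) = t₁≢t₃ (same e₁ e₃)
      go (inj₁ e₁) (inj₂ e₂) (inj₂ e₃) = t₂≢t₃ (same e₂ e₃)
      go (inj₂ e₁) (inj₁ e₂) (inj₁ e₃) = t₂≢t₃ (same e₂ e₃)
      go (inj₂ e₁) (inj₁ e₂) (inj₂ e₃) = t₁≢t₃ (same e₁ e₃)

  doubling⇒¬third : {t m : Fin n} → Doubling t m → ¬ Third t m
  doubling⇒¬third (inj₂ t≡2m) third = ℕₚ.<-asym (doubles⇒< t≡2m) (s≤s (third⇒< third))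
  doubling⇒¬third {t} (inj₁ m≡2t) (inj₁ 3t≡m)
    with () ← thrice≡twice⇒0 (ι t) (trans 3t≡m m≡2t)
  doubling⇒¬third {t} (inj₁ m≡2t) (inj₂ 3t≡2m)
    with () ← thrice≡quadruple⇒0 (ι t) (trans 3t≡2m (cong (2 *_) m≡2t))

  -- Lines of Π(n, ζ_n, G₂(I_n))

  difference : (x y : Fin n) → x Fin.< y → ∃ λ (d : Fin n) → d Fin.< y × ι d + ι x ≡ ι y
  difference x y x<y = d , d<y , d+x≡y
    where
      k = toℕ y ∸ suc (toℕ x)
      x+k≡y : suc (toℕ x) + k ≡ toℕ y
      x+k≡y = ℕₚ.m+[n∸m]≡n x<y
      k<y : k ℕ.< toℕ y
      k<y = subst (k ℕ.<_) x+k≡y (ℕₚ.m<n+m k (s≤s z≤n))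
      k<n = ℕₚ.<-trans k<y (Finₚ.toℕ<n y)
      d = fromℕ< k<n
      toℕ-d : toℕ d ≡ k
      toℕ-d = Finₚ.toℕ-fromℕ< k<n
      d<y : d Fin.< y
      d<y = subst (ℕ._< toℕ y) (sym toℕ-d) k<y
      d+x≡y : ι d + ι x ≡ ι y
      d+x≡y = cong suc (trans (cong (_+ ι x) toℕ-d) (trans (ℕₚ.+-comm k (ι x)) x+k≡y))

  sum⇒zetaGraph : {x y s : Fin n} → ι s + ι x ≡ ι y → ZetaGraph x y s y
  sum⇒zetaGraph {x} {s = s} e = sym (trans (cong (_∸ ι x) (sym e)) (ℕₚ.m+n∸n≡m (ι s) (ι x))) , refl

  bbc-line-through-c : (x y : Fin n) (x<y : x Fin.< y) →
                      ∃[ d ] BaseLine (b d) (b y) (c x y x<y) × ι d + ι x ≡ ι y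
  bbc-line-through-c x y x<y with d , d<y , e ← difference x y x<y =
    d , bbc x y d y x<y d<y (sum⇒zetaGraph e) , e

  bbc-line-through-b : (j i : Fin n) → j Fin.< i →
                    ∃[ x ] Σ (x Fin.< i) λ x<i → BaseLine (b j) (b i) (c x i x<i) × ι j + ι x ≡ ι i
  bbc-line-through-b j i j<i with d , d<i , d+j≡i ← difference j i j<i =
    d , d<i , bbc d i j i d<i j<i (sum⇒zetaGraph j+d≡i) , j+d≡i
    where j+d≡i = trans (ℕₚ.+-comm (ι j) (ι d)) d+j≡i

  a-injective : {i j : Fin n} → a i ≡ a j → i ≡ j
  a-injective refl = refl

  c-cong : {x y x′ y′ : Fin n} {h : x Fin.< y} {h′ : x′ Fin.< y′} →
           x ≡ x′ → y ≡ y′ → c x y h ≡ c x′ y′ h′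
  c-cong refl refl = cong (c _ _) (Finₚ.<-irrelevant _ _)

  c-injective : {x y x′ y′ : Fin n} {h : x Fin.< y} {h′ : x′ Fin.< y′} →
                c x y h ≡ c x′ y′ h′ → x ≡ x′ × y ≡ y′
  c-injective refl = refl , refl

  p-line : {y z : Pt n} → IsLine p y z → ∃[ k ] (y , z) ≈₂ (a k , b k)
  p-line (xyz (pab k)) = k , inj₁ (refl , refl)
  p-line (xzy (pab k)) = k , inj₂ (refl , refl)
  p-line (yxz ())
  p-line (yzx ())
  p-line (zxy ())
  p-line (zyx ())

  pc-line : {x y : Fin n} {h : x Fin.< y} {z : Pt n} → ¬ IsLine p (c x y h) z
  pc-line l with p-line l
  ... | _ , inj₁ (() , _)
  ... | _ , inj₂ (() , _)

  ap-line : {i : Fin n} {z : Pt n} → IsLine (a i) p z → z ≡ b i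
  ap-line l with p-line (IsLine-swap₁₂ l)
  ... | _ , inj₁ (refl , z≡b) = z≡b

  ab-line : {i j : Fin n} {z : Pt n} → IsLine (a i) (b j) z → z ≡ p
  ab-line (xyz ())
  ab-line (xzy ())
  ab-line (yxz ())
  ab-line (yzx ())
  ab-line (zxy (pab k)) = refl
  ab-line (zyx ())

  aa-line : {i j : Fin n} {z : Pt n} → IsLine (a i) (a j) z →
            ∃[ x ] ∃[ y ] Σ (x Fin.< y) λ h → z ≡ c x y h × (x , y) ≈₂ (i , j)
  aa-line (xyz (aac i j h)) = i , j , h , refl , inj₁ (refl , refl)
  aa-line (xzy ())
  aa-line (yxz (aac i j h)) = i , j , h , refl , inj₂ (refl , refl)
  aa-line (yzx ())
  aa-line (zxy ())
  aa-line (zyx ())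

  ac-line : {i x y : Fin n} {h : x Fin.< y} {z : Pt n} → IsLine (a i) (c x y h) z →
            ∃[ m ] z ≡ a m × (i , m) ≈₂ (x , y)
  ac-line (xyz ())
  ac-line (xzy (aac i j h)) = j , refl , inj₁ (refl , refl)
  ac-line (yxz ())
  ac-line (yzx ())
  ac-line (zxy (aac i j h)) = i , refl , inj₂ (refl , refl)
  ac-line (zyx ())

  bb-line : {i j : Fin n} {z : Pt n} → IsLine (b i) (b j) z →
            ∃[ x ] ∃[ y ] Σ (x Fin.< y) λ h → z ≡ c x y h × ZetaImage x y i j
  bb-line (xyz (bbc x y i j h _ g)) = x , y , h , refl , ordered g
  bb-line (xzy ())
  bb-line (yxz (bbc x y i j h _ g)) = x , y , h , refl , swapped g
  bb-line (yzx ())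
  bb-line (zxy ())
  bb-line (zyx ())

  bc-line : {i x y : Fin n} {h : x Fin.< y} {z : Pt n} → IsLine (b i) (c x y h) z →
            ∃[ m ] z ≡ b m × ZetaImage x y i m
  bc-line (xyz ())
  bc-line (xzy (bbc x y i j h _ g)) = j , refl , ordered g
  bc-line (yxz ())
  bc-line (yzx ())
  bc-line (zxy (bbc x y i j h _ g)) = i , refl , swapped g
  bc-line (zyx ())

  _⊆_⊖_ : Fin n × Fin n → Fin n × Fin n → Fin n × Fin n → Set
  w ⊆ u ⊖ v = ∀ e → e ∈₂ w → (e ∈₂ u × e ∉₂ v) ⊎ (e ∈₂ v × e ∉₂ u)

  ⊖-comm : ∀ {u v w} → w ⊆ u ⊖ v → w ⊆ v ⊖ u
  ⊖-comm w⊆u⊖v e e∈w with w⊆u⊖v e e∈w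
  ... | inj₁ q = inj₂ q
  ... | inj₂ q = inj₁ q

  ⊖-shared : {x₁ x₂ y e : Fin n} {w : Fin n × Fin n} →
             w ⊆ (x₁ , y) ⊖ (x₂ , y) → e ∈₂ w → e ∈₂ (x₁ , x₂)
  ⊖-shared w⊆ e∈w with w⊆ _ e∈w
  ... | inj₁ (inj₁ e≡x₁ , _)  = inj₁ e≡x₁
  ... | inj₁ (inj₂ e≡y , e∉) = ⊥-elim (e∉ (inj₂ e≡y))
  ... | inj₂ (inj₁ e≡x₂ , _)  = inj₂ e≡x₂
  ... | inj₂ (inj₂ e≡y , e∉) = ⊥-elim (e∉ (inj₂ e≡y))

  ⊆⊖-resp-≈₂ : ∀ {w u₁ u₂ v₁ v₂ u₁′ u₂′ v₁′ v₂′} →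
               (u₁ , u₂) ≈₂ (u₁′ , u₂′) → (v₁ , v₂) ≈₂ (v₁′ , v₂′) →
               w ⊆ (u₁ , u₂) ⊖ (v₁ , v₂) → w ⊆ (u₁′ , u₂′) ⊖ (v₁′ , v₂′)
  ⊆⊖-resp-≈₂ u≈ v≈ w⊆ e e∈w with w⊆ e e∈w
  ... | inj₁ (e∈u , e∉v) = inj₁ (∈₂-resp-≈₂ u≈ e∈u , e∉v ∘ ∈₂-resp-≈₂ (≈₂-sym v≈))
  ... | inj₂ (e∈v , e∉u) = inj₂ (∈₂-resp-≈₂ v≈ e∈v , e∉u ∘ ∈₂-resp-≈₂ (≈₂-sym u≈))

  module _ {α β γ : Fin n} (α<β : α Fin.< β) (β<γ : β Fin.< γ) (α<γ : α Fin.< γ) where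
    private
      α≢β = Finₚ.<⇒≢ α<β
      β≢γ = Finₚ.<⇒≢ β<γ
      α≢γ = Finₚ.<⇒≢ α<γ

    side-βγ : (β , γ) ⊆ (α , β) ⊖ (α , γ)
    side-βγ _ (inj₁ refl) = inj₁ (inj₂ refl , [ α≢β ∘ sym , β≢γ ])
    side-βγ _ (inj₂ refl) = inj₂ (inj₂ refl , [ α≢γ ∘ sym , β≢γ ∘ sym ])

    side-αγ : (α , γ) ⊆ (α , β) ⊖ (β , γ)
    side-αγ _ (inj₁ refl) = inj₁ (inj₁ refl , [ α≢β , α≢γ ])
    side-αγ _ (inj₂ refl) = inj₂ (inj₂ refl , [ α≢γ ∘ sym , β≢γ ∘ sym ])

    side-αβ : (α , β) ⊆ (α , γ) ⊖ (β , γ)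
    side-αβ _ (inj₁ refl) = inj₁ (inj₁ refl , [ α≢β , α≢γ ])
    side-αβ _ (inj₂ refl) = inj₂ (inj₁ refl , [ α≢β ∘ sym , β≢γ ])

  cc-line : {x₁ y₁ x₂ y₂ : Fin n} {h₁ : x₁ Fin.< y₁} {h₂ : x₂ Fin.< y₂} {z : Pt n} →
            IsLine (c x₁ y₁ h₁) (c x₂ y₂ h₂) z →
            ∃[ x₃ ] ∃[ y₃ ] Σ (x₃ Fin.< y₃) λ h₃ →
              z ≡ c x₃ y₃ h₃ × (x₃ , y₃) ⊆ (x₁ , y₁) ⊖ (x₂ , y₂)
  cc-line (xyz (ccc _ _ _ h₁ h₂ h₃)) = _ , _ , h₂ , refl , side-βγ h₁ h₂ h₃
  cc-line (xzy (ccc _ _ _ h₁ h₂ h₃)) = _ , _ , h₃ , refl , side-αγ h₁ h₂ h₃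
  cc-line (yxz (ccc _ _ _ h₁ h₂ h₃)) = _ , _ , h₂ , refl , ⊖-comm (side-βγ h₁ h₂ h₃)
  cc-line (yzx (ccc _ _ _ h₁ h₂ h₃)) = _ , _ , h₃ , refl , ⊖-comm (side-αγ h₁ h₂ h₃)
  cc-line (zxy (ccc _ _ _ h₁ h₂ h₃)) = _ , _ , h₁ , refl , side-αβ h₁ h₂ h₃
  cc-line (zyx (ccc _ _ _ h₁ h₂ h₃)) = _ , _ , h₁ , refl , ⊖-comm (side-αβ h₁ h₂ h₃)

  -- The c-point of an unordered pair; the junk value p for i ≡ j is never used.
  c⟨_,_⟩ : Fin n → Fin n → Pt n
  c⟨ i , j ⟩ with Finₚ.<-cmp i j
  ... | tri< i<j _ _ = c i j i<j
  ... | tri≈ _ _ _   = p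
  ... | tri> _ _ j<i = c j i j<i

  c⟨⟩-< : {i j : Fin n} (i<j : i Fin.< j) → c⟨ i , j ⟩ ≡ c i j i<j
  c⟨⟩-< {i} {j} i<j with Finₚ.<-cmp i j
  ... | tri< i<j′ _ _ = cong (c i j) (Finₚ.<-irrelevant i<j′ i<j)
  ... | tri≈ _ i≡j _  = ⊥-elim (Finₚ.<⇒≢ i<j i≡j)
  ... | tri> _ _ j<i  = ⊥-elim (ℕₚ.<-asym i<j j<i)

  c⟨⟩-> : {i j : Fin n} (j<i : j Fin.< i) → c⟨ i , j ⟩ ≡ c j i j<i
  c⟨⟩-> {i} {j} j<i with Finₚ.<-cmp i j
  ... | tri< i<j _ _  = ⊥-elim (ℕₚ.<-asym i<j j<i)
  ... | tri≈ _ i≡j _  = ⊥-elim (Finₚ.<⇒≢ j<i (sym i≡j))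
  ... | tri> _ _ j<i′ = cong (c j i) (Finₚ.<-irrelevant j<i′ j<i)

  c⟨⟩≢a : {i j m : Fin n} → c⟨ i , j ⟩ ≢ a m
  c⟨⟩≢a {i} {j} with Finₚ.<-cmp i j
  ... | tri< _ _ _ = λ ()
  ... | tri≈ _ _ _ = λ ()
  ... | tri> _ _ _ = λ ()

  c⟨⟩-∈ : {i j x y : Fin n} {h : x Fin.< y} → c⟨ i , j ⟩ ≡ c x y h → i ∈₂ (x , y)
  c⟨⟩-∈ {i} {j} with Finₚ.<-cmp i j
  ... | tri< _ _ _ = λ { refl → inj₁ refl }
  ... | tri≈ _ _ _ = λ ()
  ... | tri> _ _ _ = λ { refl → inj₂ refl }

  aac-line : {i j : Fin n} → i ≢ j → IsLine (a i) (a j) c⟨ i , j ⟩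
  aac-line {i} {j} i≢j with <⊎> i≢j
  ... | inj₁ i<j rewrite c⟨⟩-< i<j = xyz (aac i j i<j)
  ... | inj₂ j<i rewrite c⟨⟩-> j<i = yxz (aac j i j<i)

  ccc-line : {i j l : Fin n} → i ≢ j → i ≢ l → j ≢ l →
             IsLine c⟨ i , j ⟩ c⟨ i , l ⟩ c⟨ j , l ⟩
  ccc-line {i} {j} {l} i≢j i≢l j≢l with <⊎> i≢j | <⊎> i≢l | <⊎> j≢l
  ... | inj₁ i<j | inj₁ i<l | inj₁ j<l rewrite c⟨⟩-< i<j | c⟨⟩-< i<l | c⟨⟩-< j<l = xyz (ccc i j l i<j j<l i<l)
  ... | inj₁ i<j | inj₁ i<l | inj₂ l<j rewrite c⟨⟩-< i<j | c⟨⟩-< i<l | c⟨⟩-> l<j = yxz (ccc i l j i<l l<j i<j)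
  ... | inj₁ i<j | inj₂ l<i | inj₁ j<l = ⊥-elim (ℕₚ.<-asym (ℕₚ.<-trans i<j j<l) l<i)
  ... | inj₁ i<j | inj₂ l<i | inj₂ l<j rewrite c⟨⟩-< i<j | c⟨⟩-> l<i | c⟨⟩-> l<j = yzx (ccc l i j l<i i<j l<j)
  ... | inj₂ j<i | inj₁ i<l | inj₁ j<l rewrite c⟨⟩-> j<i | c⟨⟩-< i<l | c⟨⟩-< j<l = xzy (ccc j i l j<i i<l j<l)
  ... | inj₂ j<i | inj₁ i<l | inj₂ l<j = ⊥-elim (ℕₚ.<-asym (ℕₚ.<-trans i<l l<j) j<i)
  ... | inj₂ j<i | inj₂ l<i | inj₁ j<l rewrite c⟨⟩-> j<i | c⟨⟩-> l<i | c⟨⟩-< j<l = zxy (ccc j l i j<l l<i j<i)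
  ... | inj₂ j<i | inj₂ l<i | inj₂ l<j rewrite c⟨⟩-> j<i | c⟨⟩-> l<i | c⟨⟩-> l<j = zyx (ccc l j i l<j j<i l<i)

  avoiding₂ : 3 < n → (i j : Fin n) → ∃[ l ] ∃[ m ] i ≢ l × j ≢ l × i ≢ m × j ≢ m × l ≢ m
  avoiding₂ 3<n i j with l , l∉ ← fresh (i ∷ j ∷ []) (ℕₚ.<-trans (ℕₚ.n<1+n 2) 3<n)
                   with m , m∉ ← fresh (i ∷ j ∷ l ∷ []) 3<n
    = l , m , ≢-sym (l∉ ∘ here) , ≢-sym (l∉ ∘ there ∘ here)
    , ≢-sym (m∉ ∘ here) , ≢-sym (m∉ ∘ there ∘ here) , ≢-sym (m∉ ∘ there ∘ there ∘ here)

  -- Tripods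

  Quadrilateral : Pt n → Pt n → Pt n → Pt n → Pt n → Set
  Quadrilateral x y z y′ z′ = ∃[ w ] IsLine y y′ w × IsLine z z′ w × w ≢ x

  quadrilateral-swap : {x y z y′ z′ : Pt n} →
                       Quadrilateral x y z y′ z′ → Quadrilateral x y′ z′ y z
  quadrilateral-swap (w , yy′w , zz′w , w≢x) = w , IsLine-swap₁₂ yy′w , IsLine-swap₁₂ zz′w , w≢x

  record Tripod (x : Pt n) : Set where
    field
      y₁ z₁ y₂ z₂ y₃ z₃ : Pt n
      line₁ : IsLine x y₁ z₁
      line₂ : IsLine x y₂ z₂
      line₃ : IsLine x y₃ z₃
      quad₁₂ : Quadrilateral x y₁ z₁ y₂ z₂
      quad₁₃ : Quadrilateral x y₁ z₁ y₃ z₃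
      quad₂₃ : Quadrilateral x y₂ z₂ y₃ z₃

  tripod-a : 3 < n → (i : Fin n) → Tripod (a i)
  tripod-a 3<n i
    with j , j∉ ← fresh (i ∷ []) (ℕₚ.<-trans (s≤s (s≤s z≤n)) 3<n)
    with l , m , i≢l , j≢l , i≢m , j≢m , l≢m ← avoiding₂ 3<n i j
    = record
    { line₁ = aac-line i≢j ; line₂ = aac-line i≢l ; line₃ = aac-line i≢m
    ; quad₁₂ = c⟨ j , l ⟩ , aac-line j≢l , ccc-line i≢j i≢l j≢l , c⟨⟩≢a
    ; quad₁₃ = c⟨ j , m ⟩ , aac-line j≢m , ccc-line i≢j i≢m j≢m , c⟨⟩≢a
    ; quad₂₃ = c⟨ l , m ⟩ , aac-line l≢m , ccc-line i≢l i≢m l≢m , c⟨⟩≢a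
    }
    where
      i≢j : i ≢ j
      i≢j = ≢-sym (j∉ ∘ here)

  tripod-c : 3 < n → (i j : Fin n) (i<j : i Fin.< j) → Tripod (c i j i<j)
  tripod-c 3<n i j i<j with l , m , i≢l , j≢l , i≢m , j≢m , l≢m ← avoiding₂ 3<n i j = record
    { line₁ = yzx (aac i j i<j)
    ; line₂ = subst (λ q → IsLine q c⟨ i , l ⟩ c⟨ j , l ⟩) (c⟨⟩-< i<j) (ccc-line i≢j i≢l j≢l)
    ; line₃ = subst (λ q → IsLine q c⟨ i , m ⟩ c⟨ j , m ⟩) (c⟨⟩-< i<j) (ccc-line i≢j i≢m j≢m)
    ; quad₁₂ = a l , IsLine-swap₂₃ (aac-line i≢l) , IsLine-swap₂₃ (aac-line j≢l) , λ ()
    ; quad₁₃ = a m , IsLine-swap₂₃ (aac-line i≢m) , IsLine-swap₂₃ (aac-line j≢m) , λ ()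
    ; quad₂₃ = c⟨ l , m ⟩ , ccc-line i≢l i≢m l≢m , ccc-line j≢l j≢m l≢m
             , λ e → [ i≢l ∘ sym , j≢l ∘ sym ] (c⟨⟩-∈ e)
    }
    where
      i≢j : i ≢ j
      i≢j = Finₚ.<⇒≢ i<j

  tripod-image : (f : Pt n → Pt n) → Injective _≡_ _≡_ f →
                 (∀ {x y z} → IsLine x y z → IsLine (f x) (f y) (f z)) →
                 {x : Pt n} → Tripod x → Tripod (f x)
  tripod-image f f-injective f-line t = record
    { line₁ = f-line line₁ ; line₂ = f-line line₂ ; line₃ = f-line line₃
    ; quad₁₂ = quad-image quad₁₂ ; quad₁₃ = quad-image quad₁₃ ; quad₂₃ = quad-image quad₂₃ }
    where
      open Tripod t
      quad-image : ∀ {x y z y′ z′} → Quadrilateral x y z y′ z′ →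
                   Quadrilateral (f x) (f y) (f z) (f y′) (f z′)
      quad-image (w , yy′w , zz′w , w≢x) = f w , f-line yy′w , f-line zz′w , w≢x ∘ f-injective

  aa-bb-line : {k k′ : Fin n} {w : Pt n} → IsLine (a k) (a k′) w → IsLine (b k) (b k′) w →
               k ≢ k′ × Doubling k k′
  aa-bb-line aaw bbw with aa-line aaw | bb-line bbw
  ... | x , y , x<y , refl , x,y≈k,k′ | _ , _ , _ , refl , ζ =
    (λ { refl → Finₚ.<⇒≢ x<y (≈₂-diagonal x,y≈k,k′) })
    , zetaImage-fixed⇒doubling x<y ζ x,y≈k,k′

  p-quadrilateral : {k k′ : Fin n} {y z y′ z′ : Pt n} →
                    (y , z) ≈₂ (a k , b k) → (y′ , z′) ≈₂ (a k′ , b k′) →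
                    Quadrilateral p y z y′ z′ → k ≢ k′ × Doubling k k′
  p-quadrilateral (inj₁ (refl , refl)) (inj₁ (refl , refl)) (w , aaw , bbw , _) = aa-bb-line aaw bbw
  p-quadrilateral (inj₁ (refl , refl)) (inj₂ (refl , refl)) (w , abw , _ , w≢p) = ⊥-elim (w≢p (ab-line abw))
  p-quadrilateral (inj₂ (refl , refl)) (inj₁ (refl , refl)) (w , baw , _ , w≢p) =
    ⊥-elim (w≢p (ab-line (IsLine-swap₁₂ baw)))
  p-quadrilateral (inj₂ (refl , refl)) (inj₂ (refl , refl)) (w , bbw , aaw , _) = aa-bb-line aaw bbw

  ¬tripod-p : ¬ Tripod p
  ¬tripod-p t =
    let _ , L₁ = p-line line₁
        _ , L₂ = p-line line₂
        _ , L₃ = p-line line₃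
        k₁≢k₂ , d₁₂ = p-quadrilateral L₁ L₂ quad₁₂
        k₁≢k₃ , d₁₃ = p-quadrilateral L₁ L₃ quad₁₃
        k₂≢k₃ , d₂₃ = p-quadrilateral L₂ L₃ quad₂₃
    in no-doubling-triangle k₁≢k₂ k₁≢k₃ k₂≢k₃ d₁₂ d₁₃ d₂₃
    where open Tripod t

  -- No tripod at b-points

  record ZetaTriangle (j l k : Fin n) : Set where
    field
      x₁ y₁ x₂ y₂ x₃ y₃ : Fin n
      h₁ : x₁ Fin.< y₁
      h₂ : x₂ Fin.< y₂
      h₃ : x₃ Fin.< y₃
      ζ₁ : ZetaImage x₁ y₁ j k
      ζ₂ : ZetaImage x₂ y₂ l k
      ζ₃ : ZetaImage x₃ y₃ j l
      line : IsLine (c x₁ y₁ h₁) (c x₂ y₂ h₂) (c x₃ y₃ h₃)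

  zetaTriangle-swap : {j l k : Fin n} → ZetaTriangle j l k → ZetaTriangle l j k
  zetaTriangle-swap t = record
    { x₁ = x₂ ; y₁ = y₂ ; x₂ = x₁ ; y₂ = y₁ ; x₃ = x₃ ; y₃ = y₃
    ; h₁ = h₂ ; h₂ = h₁ ; h₃ = h₃ ; ζ₁ = ζ₂ ; ζ₂ = ζ₁ ; ζ₃ = zetaImage-sym ζ₃
    ; line = IsLine-swap₁₂ line }
    where open ZetaTriangle t

  zetaTriangle-rotate : {j l k : Fin n} → ZetaTriangle j l k → ZetaTriangle j k l
  zetaTriangle-rotate t = record
    { x₁ = x₃ ; y₁ = y₃ ; x₂ = x₂ ; y₂ = y₂ ; x₃ = x₁ ; y₃ = y₁
    ; h₁ = h₃ ; h₂ = h₂ ; h₃ = h₁ ; ζ₁ = ζ₃ ; ζ₂ = zetaImage-sym ζ₂ ; ζ₃ = ζ₁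
    ; line = IsLine-swap₁₂ (IsLine-swap₂₃ (IsLine-swap₁₂ line)) }
    where open ZetaTriangle t

  zetaTriangle-distinct : {j l k : Fin n} → ZetaTriangle j l k → j ≢ l × j ≢ k × l ≢ k
  zetaTriangle-distinct t =
      (λ { refl → zetaImage-irrefl h₃ ζ₃ })
    , (λ { refl → zetaImage-irrefl h₁ ζ₁ })
    , (λ { refl → zetaImage-irrefl h₂ ζ₂ })
    where open ZetaTriangle t

  zetaTriangle-thirds-sorted : {j l k : Fin n} → j Fin.< l → l Fin.< k → ZetaTriangle j l k →
                               Third j k × Third l k
  zetaTriangle-thirds-sorted {j} {l} {k} j<l l<k
    record { h₁ = h₁ ; h₂ = h₂ ; h₃ = h₃ ; ζ₁ = ζ₁ ; ζ₂ = ζ₂ ; ζ₃ = ζ₃ ; line = line }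
    with zetaImage-sum-< h₁ ζ₁ (ℕₚ.<-trans j<l l<k)
       | zetaImage-sum-< h₂ ζ₂ l<k
       | zetaImage-sum-< h₃ ζ₃ j<l
  ... | j+x₁≡k , refl | l+x₂≡k , refl | j+x₃≡l , refl
    with _ , _ , _ , refl , sides ← cc-line line
    with ⊖-shared sides (inj₁ refl) | ⊖-shared sides (inj₂ refl)
  ... | inj₁ refl | inj₁ refl = ⊥-elim (Finₚ.<⇒≢ h₃ refl)
  ... | inj₂ refl | inj₂ refl = ⊥-elim (Finₚ.<⇒≢ h₃ refl)
  ... | inj₁ refl | inj₂ refl = ⊥-elim (Finₚ.<⇒≢ l<k (ι-injective (trans (sym j+x₃≡l) j+x₁≡k)))
  ... | inj₂ refl | inj₁ refl with 3j≡k , 3l≡2k ← progression {ι j} j+x₁≡k l+x₂≡k j+x₃≡l =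
    inj₁ 3j≡k , inj₂ 3l≡2k

  zetaTriangle-thirds₃ : {j l k : Fin n} → ZetaTriangle j l k →
                         j Fin.< k → l Fin.< k → Third j k × Third l k
  zetaTriangle-thirds₃ t j<k l<k with <⊎> (proj₁ (zetaTriangle-distinct t))
  ... | inj₁ j<l = zetaTriangle-thirds-sorted j<l l<k t
  ... | inj₂ l<j = swap (zetaTriangle-thirds-sorted l<j j<k (zetaTriangle-swap t))

  zetaTriangle-thirds₂ : {j l k : Fin n} → ZetaTriangle j l k →
                         j Fin.< l → k Fin.< l → Third j l × Third k l
  zetaTriangle-thirds₂ = zetaTriangle-thirds₃ ∘ zetaTriangle-rotate

  zetaTriangle-thirds₁ : {j l k : Fin n} → ZetaTriangle j l k →
                         l Fin.< j → k Fin.< j → Third l j × Third k j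
  zetaTriangle-thirds₁ = zetaTriangle-thirds₃ ∘ zetaTriangle-rotate ∘ zetaTriangle-swap

  zetaTriangle-max : {j l k : Fin n} → ZetaTriangle j l k →
                     (Third l j × Third k j) ⊎ (Third j l × Third k l) ⊎ (Third j k × Third l k)
  zetaTriangle-max t with j≢l , j≢k , l≢k ← zetaTriangle-distinct t
    with <⊎> l≢k | <⊎> j≢k | <⊎> j≢l
  ... | inj₁ l<k | inj₁ j<k | _        = inj₂ (inj₂ (zetaTriangle-thirds₃ t j<k l<k))
  ... | inj₁ l<k | inj₂ k<j | _        = inj₁ (zetaTriangle-thirds₁ t (ℕₚ.<-trans l<k k<j) k<j)
  ... | inj₂ k<l | _        | inj₁ j<l = inj₂ (inj₁ (zetaTriangle-thirds₂ t j<l k<l))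
  ... | inj₂ k<l | _        | inj₂ l<j = inj₁ (zetaTriangle-thirds₁ t l<j (ℕₚ.<-trans k<l l<j))

  ¬zetaTriangle-doubling : {j l k : Fin n} → Doubling j k → Doubling l k → ¬ ZetaTriangle j l k
  ¬zetaTriangle-doubling j~k l~k t with zetaTriangle-max t
  ... | inj₁ (_ , k⅓j)        = doubling⇒¬third (doubling-sym j~k) k⅓j
  ... | inj₂ (inj₁ (_ , k⅓l)) = doubling⇒¬third (doubling-sym l~k) k⅓l
  ... | inj₂ (inj₂ (j⅓k , _)) = doubling⇒¬third j~k j⅓k

  ¬zetaTetrahedron : {j l m k : Fin n} → ZetaTriangle j l k → ZetaTriangle j m k → ¬ ZetaTriangle l m k
  ¬zetaTetrahedron {j} {l} {m} {k} t₁ t₂ t₃ = go (zetaTriangle-max t₃)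
    where
      j≢l = proj₁ (zetaTriangle-distinct t₁)
      j≢k = proj₁ (proj₂ (zetaTriangle-distinct t₁))
      j≢m = proj₁ (zetaTriangle-distinct t₂)
      l≢m = proj₁ (zetaTriangle-distinct t₃)
      l≢k = proj₁ (proj₂ (zetaTriangle-distinct t₃))
      m≢k = proj₂ (proj₂ (zetaTriangle-distinct t₃))

      j-max : l Fin.< j → m Fin.< j → k Fin.< j → ⊥
      j-max l<j m<j k<j with l⅓j , k⅓j ← zetaTriangle-thirds₁ t₁ l<j k<j =
        ¬three-thirds l≢m l≢k m≢k l⅓j (proj₁ (zetaTriangle-thirds₁ t₂ m<j k<j)) k⅓j

      go : (Third m l × Third k l) ⊎ (Third l m × Third k m) ⊎ (Third l k × Third m k) → ⊥
      go (inj₁ (m⅓l , k⅓l)) with <⊎> j≢l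
      ... | inj₁ j<l =
        ¬three-thirds j≢m j≢k m≢k (proj₁ (zetaTriangle-thirds₂ t₁ j<l (third⇒< k⅓l))) m⅓l k⅓l
      ... | inj₂ l<j = j-max l<j (ℕₚ.<-trans (third⇒< m⅓l) l<j) (ℕₚ.<-trans (third⇒< k⅓l) l<j)
      go (inj₂ (inj₁ (l⅓m , k⅓m))) with <⊎> j≢m
      ... | inj₁ j<m =
        ¬three-thirds j≢l j≢k l≢k (proj₁ (zetaTriangle-thirds₂ t₂ j<m (third⇒< k⅓m))) l⅓m k⅓m
      ... | inj₂ m<j = j-max (ℕₚ.<-trans (third⇒< l⅓m) m<j) m<j (ℕₚ.<-trans (third⇒< k⅓m) m<j)
      go (inj₂ (inj₂ (l⅓k , m⅓k))) with <⊎> j≢k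
      ... | inj₁ j<k =
        ¬three-thirds j≢l j≢m l≢m (proj₁ (zetaTriangle-thirds₃ t₁ j<k (third⇒< l⅓k))) l⅓k m⅓k
      ... | inj₂ k<j = j-max (ℕₚ.<-trans (third⇒< l⅓k) k<j) (ℕₚ.<-trans (third⇒< m⅓k) k<j) k<j

  data BLine (k : Fin n) : Pt n → Pt n → Set where
    p-a : BLine k p (a k)
    a-p : BLine k (a k) p
    b-c : (j x y : Fin n) (h : x Fin.< y) → ZetaImage x y j k → BLine k (b j) (c x y h)
    c-b : (j x y : Fin n) (h : x Fin.< y) → ZetaImage x y j k → BLine k (c x y h) (b j)

  b-line : {k : Fin n} {y z : Pt n} → IsLine (b k) y z → BLine k y z
  b-line (xyz (bbc x y _ j h _ g)) = b-c j x y h (swapped g)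
  b-line (xzy (bbc x y _ j h _ g)) = c-b j x y h (swapped g)
  b-line (yxz (bbc x y j _ h _ g)) = b-c j x y h (ordered g)
  b-line (yzx (pab _))             = p-a
  b-line (zxy (bbc x y j _ h _ g)) = c-b j x y h (ordered g)
  b-line (zyx (pab _))             = a-p

  partner : {k : Fin n} {y z : Pt n} → BLine k y z → Maybe (Fin n)
  partner p-a             = nothing
  partner a-p             = nothing
  partner (b-c j _ _ _ _) = just j
  partner (c-b j _ _ _ _) = just j

  -- What a quadrilateral through b k forces on the partners of its two lines
  -- (nothing stands for the line b k, p, a k).
  Compatible : Fin n → Maybe (Fin n) → Maybe (Fin n) → Set
  Compatible k nothing  nothing  = ⊥
  Compatible k nothing  (just j) = Doubling j k
  Compatible k (just j) nothing  = Doubling j k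
  Compatible k (just j) (just l) = ZetaTriangle j l k

  ¬compatible-triangle : {k : Fin n} (u v w : Maybe (Fin n)) →
                         Compatible k u v → Compatible k u w → Compatible k v w → ⊥
  ¬compatible-triangle nothing  nothing  _        ()
  ¬compatible-triangle nothing  (just j) nothing  _  ()
  ¬compatible-triangle (just j) nothing  nothing  _  _  ()
  ¬compatible-triangle nothing  (just j) (just l) dj dl t = ¬zetaTriangle-doubling dj dl t
  ¬compatible-triangle (just j) nothing  (just l) dj t dl = ¬zetaTriangle-doubling dj dl t
  ¬compatible-triangle (just j) (just l) nothing  t dj dl = ¬zetaTriangle-doubling dj dl t
  ¬compatible-triangle (just j) (just l) (just m) t₁ t₂ t₃ = ¬zetaTetrahedron t₁ t₂ t₃

  doubling-of-ac-line : {j k m x y : Fin n} → x Fin.< y → ZetaImage x y j k → m ≡ j →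
                        (k , m) ≈₂ (x , y) → Doubling j k
  doubling-of-ac-line x<y ζ refl (inj₁ (refl , refl)) = zetaImage-fixed⇒doubling x<y ζ (inj₂ (refl , refl))
  doubling-of-ac-line x<y ζ refl (inj₂ (refl , refl)) = zetaImage-fixed⇒doubling x<y ζ (inj₁ (refl , refl))

  module _ {k j x y : Fin n} {h : x Fin.< y} (ζ : ZetaImage x y j k) where

    pa-quadrilateral : {y′ z′ : Pt n} → (y′ , z′) ≈₂ (b j , c x y h) →
                       Quadrilateral (b k) p (a k) y′ z′ → Doubling j k
    pa-quadrilateral (inj₁ (refl , refl)) (w , pbw , acw , _) with p-line pbw
    ... | _ , inj₁ (() , _)
    ... | _ , inj₂ (refl , refl) with _ , refl , k,m≈x,y ← ac-line acw = doubling-of-ac-line h ζ refl k,m≈x,y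
    pa-quadrilateral (inj₂ (refl , refl)) (w , pcw , _ , _) = ⊥-elim (pc-line pcw)

    ap-quadrilateral : {y′ z′ : Pt n} → (y′ , z′) ≈₂ (b j , c x y h) →
                       Quadrilateral (b k) (a k) p y′ z′ → Doubling j k
    ap-quadrilateral (inj₁ (refl , refl)) (w , _ , pcw , _) = ⊥-elim (pc-line pcw)
    ap-quadrilateral (inj₂ (refl , refl)) (w , acw , pbw , _)
      with _ , refl , k,m≈x,y ← ac-line acw with p-line pbw
    ... | _ , inj₁ (() , _)
    ... | _ , inj₂ (refl , refl) = doubling-of-ac-line h ζ refl k,m≈x,y

  b-quadrilateral : {k : Fin n} {y z y′ z′ : Pt n} (L : BLine k y z) (L′ : BLine k y′ z′) →
                    Quadrilateral (b k) y z y′ z′ → Compatible k (partner L) (partner L′)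
  b-quadrilateral p-a p-a (w , ppw , _ , _) with p-line ppw
  ... | _ , inj₁ (() , _)
  ... | _ , inj₂ (() , _)
  b-quadrilateral p-a a-p (w , paw , _ , w≢b) with p-line paw
  ... | _ , inj₁ (refl , w≡b) = w≢b w≡b
  ... | _ , inj₂ (() , _)
  b-quadrilateral a-p p-a (w , apw , _ , w≢b) = w≢b (ap-line apw)
  b-quadrilateral a-p a-p (w , aaw , _ , _) with _ , _ , x<y , _ , x,y≈k,k ← aa-line aaw =
    Finₚ.<⇒≢ x<y (≈₂-diagonal x,y≈k,k)
  b-quadrilateral p-a (b-c j x y h ζ) q = pa-quadrilateral ζ (inj₁ (refl , refl)) q
  b-quadrilateral p-a (c-b j x y h ζ) q = pa-quadrilateral ζ (inj₂ (refl , refl)) q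
  b-quadrilateral a-p (b-c j x y h ζ) q = ap-quadrilateral ζ (inj₁ (refl , refl)) q
  b-quadrilateral a-p (c-b j x y h ζ) q = ap-quadrilateral ζ (inj₂ (refl , refl)) q
  b-quadrilateral (b-c j x y h ζ) p-a q = pa-quadrilateral ζ (inj₁ (refl , refl)) (quadrilateral-swap q)
  b-quadrilateral (c-b j x y h ζ) p-a q = pa-quadrilateral ζ (inj₂ (refl , refl)) (quadrilateral-swap q)
  b-quadrilateral (b-c j x y h ζ) a-p q = ap-quadrilateral ζ (inj₁ (refl , refl)) (quadrilateral-swap q)
  b-quadrilateral (c-b j x y h ζ) a-p q = ap-quadrilateral ζ (inj₂ (refl , refl)) (quadrilateral-swap q)
  b-quadrilateral (b-c j x₁ y₁ h₁ ζ₁) (b-c l x₂ y₂ h₂ ζ₂) (w , bbw , ccw , _)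
    with x₃ , y₃ , h₃ , refl , ζ₃ ← bb-line bbw =
    record { h₁ = h₁ ; h₂ = h₂ ; h₃ = h₃ ; ζ₁ = ζ₁ ; ζ₂ = ζ₂ ; ζ₃ = ζ₃ ; line = ccw }
  b-quadrilateral (c-b j x₁ y₁ h₁ ζ₁) (c-b l x₂ y₂ h₂ ζ₂) (w , ccw , bbw , _)
    with x₃ , y₃ , h₃ , refl , ζ₃ ← bb-line bbw =
    record { h₁ = h₁ ; h₂ = h₂ ; h₃ = h₃ ; ζ₁ = ζ₁ ; ζ₂ = ζ₂ ; ζ₃ = ζ₃ ; line = ccw }
  b-quadrilateral (b-c j x₁ y₁ h₁ ζ₁) (c-b l x₂ y₂ h₂ ζ₂) (w , bcw , _ , w≢b)
    with _ , refl , ζ ← bc-line bcw with zetaImage-functional h₂ ζ ζ₂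
  ... | inj₁ (refl , refl) = ⊥-elim (w≢b refl)
  ... | inj₂ (refl , refl) = ⊥-elim (zetaImage-irrefl h₁ ζ₁)
  b-quadrilateral (c-b j x₁ y₁ h₁ ζ₁) (b-c l x₂ y₂ h₂ ζ₂) (w , cbw , _ , w≢b)
    with _ , refl , ζ ← bc-line (IsLine-swap₁₂ cbw) with zetaImage-functional h₁ ζ ζ₁
  ... | inj₁ (refl , refl) = ⊥-elim (w≢b refl)
  ... | inj₂ (refl , refl) = ⊥-elim (zetaImage-irrefl h₂ ζ₂)

  ¬tripod-b : {k : Fin n} → ¬ Tripod (b k)
  ¬tripod-b t = ¬compatible-triangle (partner L₁) (partner L₂) (partner L₃)
    (b-quadrilateral L₁ L₂ quad₁₂)
    (b-quadrilateral L₁ L₃ quad₁₃)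
    (b-quadrilateral L₂ L₃ quad₂₃)
    where
      open Tripod t
      L₁ = b-line line₁
      L₂ = b-line line₂
      L₃ = b-line line₃

  p-line-tripod : {y z : Pt n} → IsLine p y z → Tripod z → ∃[ m ] y ≡ b m × z ≡ a m
  p-line-tripod l t with p-line l
  ... | m , inj₁ (refl , refl) = ⊥-elim (¬tripod-b t)
  ... | m , inj₂ (refl , refl) = m , refl , refl

-- Automorphisms

module _ {n′ : ℕ} (f : Pt (4 + n′) → Pt (4 + n′)) (f-injective : Injective _≡_ _≡_ f)
         (f-line : ∀ {x y z} → IsLine x y z → IsLine (f x) (f y) (f z)) where

  private
    N : ℕ
    N = 4 + n′

    3<N : 3 < N
    3<N = s≤s (s≤s (s≤s (s≤s z≤n)))

    -- named after the numbers ι they stand for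
    one two three four : Fin N
    one   = Fin.zero
    two   = Fin.suc Fin.zero
    three = Fin.suc (Fin.suc Fin.zero)
    four  = Fin.suc (Fin.suc (Fin.suc Fin.zero))

  f-tripod : {x : Pt N} → Tripod x → Tripod (f x)
  f-tripod = tripod-image f f-injective f-line

  line-image : {x y z x′ y′ z′ : Pt N} → BaseLine x y z →
               f x ≡ x′ → f y ≡ y′ → f z ≡ z′ → IsLine x′ y′ z′
  line-image l refl refl refl = f-line (xyz l)

  larger-non-double : (i : Fin N) → suc (toℕ i) ℕ.< N →
                      ∃ λ (l : Fin N) → i Fin.< l × ι l ≢ ι i + ι i
  larger-non-double Fin.zero        _     = three , s≤s z≤n , λ ()
  larger-non-double i@(Fin.suc _) i+1<N = fromℕ< i+1<N , i<l , succ≢double toℕ-l (s≤s z≤n)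
    where
      toℕ-l : toℕ (fromℕ< i+1<N) ≡ suc (toℕ i)
      toℕ-l = Finₚ.toℕ-fromℕ< i+1<N
      i<l : i Fin.< fromℕ< i+1<N
      i<l = subst (toℕ i ℕ.<_) (sym toℕ-l) (ℕₚ.n<1+n (toℕ i))

  module _ {i k : Fin N} (fbi≡p : f (b i) ≡ p) (fp≡bk : f p ≡ b k) (fai≡ak : f (a i) ≡ a k) where

    fb≢bk : {u : Fin N} → f (b u) ≢ b k
    fb≢bk e with () ← f-injective (trans e (sym fp≡bk))

    same-b-image : {u v M M′ : Fin N} → f (b u) ≡ b M → f (b v) ≡ b M′ → M ≡ M′ → u ≡ v
    same-b-image fbu fbv refl with refl ← f-injective (trans fbu (sym fbv)) = refl

    b-line-image : {y z : Pt N} → IsLine (b i) y z → Tripod z → ∃[ M ] f y ≡ b M × f z ≡ a M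
    b-line-image {y} {z} l t =
      p-line-tripod (subst (λ q → IsLine q (f y) (f z)) fbi≡p (f-line l)) (f-tripod t)

    f-b≡b : {j : Fin N} → j ≢ i → ∃[ M ] f (b j) ≡ b M
    f-b≡b {j} j≢i with <⊎> j≢i
    ... | inj₁ j<i =
      let x , x<i , bl , _ = bbc-line-through-b j i j<i
          M , fbj≡bM , _ = b-line-image (yxz bl) (tripod-c 3<N x i x<i)
      in M , fbj≡bM
    ... | inj₂ i<j =
      let x , x<j , bl , _ = bbc-line-through-b i j i<j
          M , fbj≡bM , _ = b-line-image (xyz bl) (tripod-c 3<N x j x<j)
      in M , fbj≡bM

    f-a≡c : {j : Fin N} → j ≢ i → ∃[ x ] ∃[ y ] Σ (x Fin.< y) λ h → f (a j) ≡ c x y h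
    f-a≡c {j} j≢i =
      let M , fbj≡bM = f-b≡b j≢i
          x , y , h , faj≡c , _ = bb-line (IsLine-swap₂₃ (line-image (pab j) fp≡bk refl fbj≡bM))
      in x , y , h , faj≡c

    -- The image of the line a x, a l, c would contain two c-points and the a-point f c.
    ¬bbc-line-avoiding : {x l : Fin N} (x<l : x Fin.< l) → x ≢ i → l ≢ i →
                         ¬ BaseLine (b i) (b l) (c x l x<l)
    ¬bbc-line-avoiding {x} {l} x<l x≢i l≢i bl =
      let _ , _ , _ , fax = f-a≡c x≢i
          _ , _ , _ , fal = f-a≡c l≢i
          _ , _ , _ , fc≡c , _ = cc-line (line-image (aac x l x<l) fax fal refl)
          _ , _ , fc≡a = b-line-image (xyz bl) (tripod-c 3<N x l x<l)
      in c≢a (trans (sym fc≡c) fc≡a)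
      where
        c≢a : ∀ {u v w} {h : u Fin.< v} → c u v h ≢ a w
        c≢a ()

    ¬below-last : suc (toℕ i) ℕ.< N → ⊥
    ¬below-last i+1<N =
      let l , i<l , l≢2i = larger-non-double i i+1<N
          x , x<l , bl , i+x≡l = bbc-line-through-b i l i<l
          x≢i = λ x≡i → l≢2i (sym (subst (λ y → ι i + ι y ≡ ι l) x≡i i+x≡l))
      in ¬bbc-line-avoiding x<l x≢i (Finₚ.<⇒≢ i<l ∘ sym) bl

    -- For x < i, the line b K, b i, c x i with K = i − x shows f(c x i) = a M and
    -- f(b K) = b M; the line a x, a i, c x i then gives f(a x) = c{k, M}.
    record BelowI (x : Fin N) : Set where
      field
        K M x′ y′ : Fin N
        x′<y′ : x′ Fin.< y′
        K+x≡i : ι K + ι x ≡ ι i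
        fbK≡bM : f (b K) ≡ b M
        fax≡c : f (a x) ≡ c x′ y′ x′<y′
        x′y′≈kM : (x′ , y′) ≈₂ (k , M)

    belowI : {x : Fin N} → x Fin.< i → BelowI x
    belowI {x} x<i =
      let K , bl , K+x≡i = bbc-line-through-c x i x<i
          M , fbK≡bM , fc≡aM = b-line-image (yxz bl) (tripod-c 3<N x i x<i)
          _ , _ , _ , fax≡c , x′y′≈kM =
            aa-line (IsLine-rotate (line-image (aac x i x<i) refl fai≡ak fc≡aM))
      in record { K+x≡i = K+x≡i ; fbK≡bM = fbK≡bM ; fax≡c = fax≡c ; x′y′≈kM = x′y′≈kM }

    belowI-K≢ : {x u : Fin N} (B : BelowI x) → ι u + ι x ≢ ι i → BelowI.K B ≢ u
    belowI-K≢ {x} B u+x≢i K≡u = u+x≢i (subst (λ v → ι v + ι x ≡ ι i) K≡u (BelowI.K+x≡i B))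

    -- read off from the image b k, c{k, M}, b mₓ of the line p, a x, b x
    belowI-sum : {x mₓ : Fin N} (B : BelowI x) → f (b x) ≡ b mₓ → BelowI.K B ≢ x →
                 ι mₓ + ι (BelowI.M B) ≡ ι k
    belowI-sum {x} B fbx≡bm K≢x
      with bb-line (IsLine-swap₂₃ (line-image (pab x) fp≡bk (BelowI.fax≡c B) fbx≡bm))
    ... | _ , _ , _ , refl , ζ with BelowI.x′y′≈kM B
    ...   | inj₁ (refl , refl) with zetaImage-max ζ
    ...     | inj₁ refl = ⊥-elim (fb≢bk (BelowI.fbK≡bM B))
    ...     | inj₂ refl = ⊥-elim (K≢x (same-b-image (BelowI.fbK≡bM B) fbx≡bm refl))
    belowI-sum B fbx≡bm K≢x | _ , _ , h , refl , ζ | inj₂ (refl , refl) with zetaImage-sum h ζ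
    ...     | inj₁ (_ , refl) = ⊥-elim (fb≢bk fbx≡bm)
    ...     | inj₂ (sum , _)  = sum

    -- f(c one two) = c{x₃, y₃} lies on the images of the lines a one, a two, c one two and
    -- b one, b two, c one two; comparing the two descriptions of y₃ leaves only n = 4,
    -- where M₂ = m₁ + M₁ = k contradicts injectivity.
    ¬at-last-from : toℕ i ≡ 3 + n′ → BelowI one → BelowI two →
                    ∃[ m₁ ] f (b one) ≡ b m₁ → ∃[ m₂ ] f (b two) ≡ b m₂ → ⊥
    ¬at-last-from i-last B₁ B₂ (m₁ , fb₁) (m₂ , fb₂) =
      let x₃ , y₃ , h₃ , fc≡c₃ , sides = cc-line (line-image (aac one two (s≤s z≤n)) fa₁ fa₂ refl)
          _ , _ , _ , fc≡c₃′ , ζ′ =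
            bb-line (line-image (bbc one two one two (s≤s z≤n) (s≤s z≤n) (refl , refl)) fb₁ fb₂ refl)
          x₃≡ , y₃≡ = c-injective (trans (sym fc≡c₃) fc≡c₃′)
          ζ = subst₂ (λ u v → ZetaImage u v m₁ m₂) (sym x₃≡) (sym y₃≡) ζ′
          sides′ = ⊆⊖-resp-≈₂ (≈₂-swap (BelowI.x′y′≈kM B₁)) (≈₂-swap (BelowI.x′y′≈kM B₂))
                               sides
      in cases h₃ ζ (⊖-shared sides′ (inj₁ refl)) (⊖-shared sides′ (inj₂ refl)) (zetaImage-max ζ)
      where
        open BelowI B₁ using () renaming (K to K₁; M to M₁; fax≡c to fa₁; fbK≡bM to fbK₁)
        open BelowI B₂ using () renaming (K to K₂; M to M₂; fax≡c to fa₂; fbK≡bM to fbK₂)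

        small : {s : ℕ} → s ℕ.< 4 → s ≢ ι i
        small s<4 s≡i =
          ℕₚ.<⇒≢ (ℕₚ.<-≤-trans s<4 (s≤s (s≤s (s≤s (s≤s z≤n))))) (trans s≡i (cong suc i-last))

        K₁≢one : K₁ ≢ one
        K₁≢one = belowI-K≢ B₁ (small (s≤s (s≤s (s≤s z≤n))))
        K₁≢two : K₁ ≢ two
        K₁≢two = belowI-K≢ B₁ (small ℕₚ.≤-refl)
        K₂≢one : K₂ ≢ one
        K₂≢one = belowI-K≢ B₂ (small ℕₚ.≤-refl)

        cases : {x₃ y₃ : Fin N} → x₃ Fin.< y₃ → ZetaImage x₃ y₃ m₁ m₂ →
                x₃ ∈₂ (M₁ , M₂) → y₃ ∈₂ (M₁ , M₂) → y₃ ∈₂ (m₁ , m₂) → ⊥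
        cases _  _ _           (inj₁ refl) (inj₁ M₁≡m₁) = K₁≢one (same-b-image fbK₁ fb₁ M₁≡m₁)
        cases _  _ _           (inj₁ refl) (inj₂ M₁≡m₂) = K₁≢two (same-b-image fbK₁ fb₂ M₁≡m₂)
        cases _  _ _           (inj₂ refl) (inj₁ M₂≡m₁) = K₂≢one (same-b-image fbK₂ fb₁ M₂≡m₁)
        cases h₃ _ (inj₂ refl) (inj₂ refl) _            = Finₚ.<⇒≢ h₃ refl
        cases h₃ ζ (inj₁ refl) (inj₂ refl) (inj₂ M₂≡m₂) with zetaImage-sum h₃ ζ
        ... | inj₁ (m₁+M₁≡M₂ , _) =
          let M₂≡k = ι-injective (trans (sym m₁+M₁≡M₂) (belowI-sum B₁ fb₁ K₁≢one))
          in fb≢bk (trans fbK₂ (cong b M₂≡k))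
        ... | inj₂ (_ , m₁≡M₂) with () ← same-b-image fb₁ fb₂ (trans m₁≡M₂ M₂≡m₂)

    ¬at-last : toℕ i ≡ 3 + n′ → ⊥
    ¬at-last i-last = ¬at-last-from i-last (belowI one<i) (belowI two<i)
                        (f-b≡b (Finₚ.<⇒≢ one<i)) (f-b≡b (Finₚ.<⇒≢ two<i))
      where
        one<i : one Fin.< i
        one<i = subst (0 ℕ.<_) (sym i-last) (s≤s z≤n)
        two<i : two Fin.< i
        two<i = subst (1 ℕ.<_) (sym i-last) (s≤s (s≤s z≤n))

  below-last⊎last : (i : Fin N) → suc (toℕ i) ℕ.< N ⊎ toℕ i ≡ 3 + n′
  below-last⊎last i with ℕₚ.m≤n⇒m<n∨m≡n (Finₚ.toℕ<n i)
  ... | inj₁ i+1<N = inj₁ i+1<N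
  ... | inj₂ i+1≡N = inj₂ (ℕₚ.suc-injective i+1≡N)

  f-b≢p : {i : Fin N} → f (b i) ≢ p
  f-b≢p {i} fbi≡p =
    let k , fp≡bk , fai≡ak = p-line-tripod (IsLine-rotate (IsLine-rotate (line-image (pab i) refl refl fbi≡p)))
                                           (f-tripod (tripod-a 3<N i))
    in [ ¬below-last fbi≡p fp≡bk fai≡ak , ¬at-last fbi≡p fp≡bk fai≡ak ] (below-last⊎last i)

  f-p≡p : Surjective _≡_ _≡_ f → f p ≡ p
  f-p≡p surjective with surjective p
  ... | p       , fx≡p = fx≡p refl
  ... | a i     , fx≡p = ⊥-elim (¬tripod-p (subst Tripod (fx≡p refl) (f-tripod (tripod-a 3<N i))))
  ... | b i     , fx≡p = ⊥-elim (f-b≢p (fx≡p refl))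
  ... | c i j h , fx≡p = ⊥-elim (¬tripod-p (subst Tripod (fx≡p refl) (f-tripod (tripod-c 3<N i j h))))

  ab-image : f p ≡ p → (i : Fin N) → ∃[ j ] f (b i) ≡ b j × f (a i) ≡ a j
  ab-image fp≡p i =
    p-line-tripod (IsLine-swap₂₃ (line-image (pab i) fp≡p refl refl)) (f-tripod (tripod-a 3<N i))

  module _ (φ : Fin N → Fin N)
           (f-b≡ : ∀ i → f (b i) ≡ b (φ i)) (f-a≡ : ∀ i → f (a i) ≡ a (φ i)) where

    φ-injective : {i j : Fin N} → φ i ≡ φ j → i ≡ j
    φ-injective {i} {j} e = a-injective (f-injective (trans (f-a≡ i) (trans (cong a e) (sym (f-a≡ j)))))

    -- f c{i,j} = c{φ i, φ j}, and φ commutes with ζ: ζ{φ i, φ j} = {φ d, φ j} for d = j − i.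
    record CImage (i j : Fin N) (i<j : i Fin.< j) : Set where
      field
        x y : Fin N
        x<y : x Fin.< y
        fc≡c : f (c i j i<j) ≡ c x y x<y
        x,y≈φi,φj : (x , y) ≈₂ (φ i , φ j)
        d : Fin N
        d+i≡j : ι d + ι i ≡ ι j
        ζ : ZetaImage x y (φ d) (φ j)

    c-image : (i j : Fin N) (i<j : i Fin.< j) → CImage i j i<j
    c-image i j i<j =
      let x , y , x<y , fc≡c , x,y≈φi,φj = aa-line (line-image (aac i j i<j) (f-a≡ i) (f-a≡ j) refl)
          d , bl , d+i≡j = bbc-line-through-c i j i<j
          _ , _ , _ , fc≡c′ , ζ′ = bb-line (line-image bl (f-b≡ d) (f-b≡ j) refl)
          x≡ , y≡ = c-injective (trans (sym fc≡c) fc≡c′)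
      in record { fc≡c = fc≡c ; x,y≈φi,φj = x,y≈φi,φj ; d+i≡j = d+i≡j
                ; ζ = subst₂ (λ u v → ZetaImage u v (φ d) (φ j)) (sym x≡) (sym y≡) ζ′ }

    -- If φ reversed i < j, the larger φ i would have to be φ d or φ j.
    φ-<-from : {i j : Fin N} {i<j : i Fin.< j} → CImage i j i<j → ι j ≢ ι i + ι i → φ i Fin.< φ j
    φ-<-from record { x<y = x<y ; x,y≈φi,φj = inj₁ (refl , refl) } _ = x<y
    φ-<-from {i<j = i<j} record { x,y≈φi,φj = inj₂ (refl , refl) ; d+i≡j = d+i≡j ; ζ = ζ } j≢2i
      with zetaImage-max ζ
    ... | inj₁ φi≡φd =
      ⊥-elim (j≢2i (trans (sym d+i≡j) (cong (λ u → ι u + ι _) (sym (φ-injective φi≡φd)))))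
    ... | inj₂ φi≡φj = ⊥-elim (Finₚ.<⇒≢ i<j (φ-injective φi≡φj))

    φ-< : {i j : Fin N} → i Fin.< j → ι j ≢ ι i + ι i → φ i Fin.< φ j
    φ-< {i} {j} i<j = φ-<-from (c-image i j i<j)

    φ-<-succ : {i j : Fin N} → toℕ j ≡ suc (toℕ i) → 0 ℕ.< toℕ i → φ i Fin.< φ j
    φ-<-succ {i} j≡i+1 0<i =
      φ-< (subst (toℕ i ℕ.<_) (sym j≡i+1) (ℕₚ.n<1+n (toℕ i))) (succ≢double j≡i+1 0<i)

    φ-lower : ∀ d (i : Fin N) → toℕ i ≡ 2 + d → 2 + d ℕ.≤ toℕ (φ i)
    φ-lower zero i i≡2 = subst (λ u → 2 ℕ.≤ toℕ (φ u)) (Finₚ.toℕ-injective (sym i≡2)) (two-below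
      (λ φ1≡φ2 → contradiction (φ-injective (Finₚ.toℕ-injective φ1≡φ2)) λ ())
      (φ-< {one} {three} (s≤s z≤n) λ ())
      (φ-< {two} {three} (s≤s (s≤s z≤n)) λ ()))
    φ-lower (suc d) i i≡3+d =
      ℕₚ.<-≤-trans (s≤s (φ-lower d i⁻ i⁻≡2+d))
        (φ-<-succ (trans i≡3+d (cong suc (sym i⁻≡2+d))) (subst (0 ℕ.<_) (sym i⁻≡2+d) (s≤s z≤n)))
      where
        2+d<N : 2 + d ℕ.< N
        2+d<N = ℕₚ.<-trans (ℕₚ.n<1+n (2 + d)) (subst (ℕ._< N) i≡3+d (Finₚ.toℕ<n i))
        i⁻ = fromℕ< 2+d<N
        i⁻≡2+d : toℕ i⁻ ≡ 2 + d
        i⁻≡2+d = Finₚ.toℕ-fromℕ< 2+d<N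

    φ-upper : ∀ d (i : Fin N) → toℕ i + d ≡ 3 + n′ → 0 ℕ.< toℕ i → toℕ (φ i) ℕ.≤ toℕ i
    φ-upper zero i i+0≡last _ =
      subst (toℕ (φ i) ℕ.≤_) (trans (sym i+0≡last) (ℕₚ.+-identityʳ (toℕ i)))
        (ℕₚ.≤-pred (Finₚ.toℕ<n (φ i)))
    φ-upper (suc d) i i+1+d≡last 0<i =
      ℕₚ.≤-pred (ℕₚ.<-≤-trans (φ-<-succ i⁺≡i+1 0<i)
        (subst (toℕ (φ i⁺) ℕ.≤_) i⁺≡i+1 (φ-upper d i⁺ i⁺+d≡last (s≤s z≤n))))
      where
        i+1<N : suc (toℕ i) ℕ.< N
        i+1<N = s≤s (subst (suc (toℕ i) ℕ.≤_) (trans (sym (ℕₚ.+-suc (toℕ i) d)) i+1+d≡last)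
                      (s≤s (ℕₚ.m≤m+n (toℕ i) d)))
        i⁺ = fromℕ< i+1<N
        i⁺≡i+1 : toℕ i⁺ ≡ suc (toℕ i)
        i⁺≡i+1 = Finₚ.toℕ-fromℕ< i+1<N
        i⁺+d≡last : toℕ i⁺ + d ≡ 3 + n′
        i⁺+d≡last = trans (cong (_+ d) i⁺≡i+1) (trans (sym (ℕₚ.+-suc (toℕ i) d)) i+1+d≡last)

    φ-fixed : (i : Fin N) → 2 ℕ.≤ toℕ i → φ i ≡ i
    φ-fixed i 2≤i = Finₚ.toℕ-injective (ℕₚ.≤-antisym
      (φ-upper (3 + n′ ∸ toℕ i) i (ℕₚ.m+[n∸m]≡n (ℕₚ.≤-pred (Finₚ.toℕ<n i)))
               (ℕₚ.<-≤-trans (s≤s z≤n) 2≤i))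
      (subst (ℕ._≤ toℕ (φ i)) 2+[i∸2]≡i (φ-lower (toℕ i ∸ 2) i (sym 2+[i∸2]≡i))))
      where 2+[i∸2]≡i = ℕₚ.m+[n∸m]≡n 2≤i

    below-three : {u : Fin N} → u Fin.< three → u ≡ one ⊎ u ≡ two
    below-three {Fin.zero}                  _ = inj₁ refl
    below-three {Fin.suc Fin.zero}          _ = inj₂ refl
    below-three {Fin.suc (Fin.suc _)} (s≤s (s≤s ()))

    φ-below-three : {i : Fin N} → i Fin.< three → ι three ≢ ι i + ι i → φ i ≡ one ⊎ φ i ≡ two
    φ-below-three i<three 3≢2i =
      below-three (subst (φ _ Fin.<_) (φ-fixed three ℕₚ.≤-refl) (φ-< i<three 3≢2i))

    φ-three : {d : Fin N} → ι d + ι one ≡ ι four → φ d ≡ three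
    φ-three {d} d+1≡4 =
      trans (cong φ (ι-injective (ℕₚ.+-cancelʳ-≡ 1 (ι d) 3 d+1≡4))) (φ-fixed three ℕₚ.≤-refl)

    φ-four : φ four ≡ four
    φ-four = φ-fixed four (s≤s (s≤s z≤n))

    -- If φ swapped one and two, then f c{one, four} = c{two, four}, but
    -- ζ{two, four} = {two, four} differs from {φ three, φ four} = {three, four}.
    ¬φ-swap-from : {h : one Fin.< four} → CImage one four h → φ one ≡ two → ⊥
    ¬φ-swap-from record { x<y = x<y ; x,y≈φi,φj = inj₂ (refl , refl) } φ1≡2
      with s≤s () ← subst₂ Fin._<_ φ-four φ1≡2 x<y
    ¬φ-swap-from record { x<y = x<y ; x,y≈φi,φj = inj₁ (refl , refl) ; d+i≡j = d+i≡j ; ζ = ζ } φ1≡2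
      with zetaImage-sum x<y ζ
    ... | inj₁ (sum , _)
      with () ← trans (sym (cong₂ _+_ (cong ι (φ-three d+i≡j)) (cong ι φ1≡2)))
                      (trans sum (cong ι φ-four))
    ... | inj₂ (sum , _) = ι+ι≢ι _ _ sum

    φ-one-two : φ one ≡ one × φ two ≡ two
    φ-one-two with φ-below-three {one} (s≤s z≤n) (λ ()) | φ-below-three {two} (s≤s (s≤s z≤n)) (λ ())
    ... | inj₁ φ1≡1 | inj₂ φ2≡2 = φ1≡1 , φ2≡2
    ... | inj₁ φ1≡1 | inj₁ φ2≡1 with () ← φ-injective (trans φ1≡1 (sym φ2≡1))
    ... | inj₂ φ1≡2 | inj₂ φ2≡2 with () ← φ-injective (trans φ1≡2 (sym φ2≡2))
    ... | inj₂ φ1≡2 | inj₁ _    = ⊥-elim (¬φ-swap-from (c-image one four (s≤s z≤n)) φ1≡2)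

    φ≡id : (i : Fin N) → φ i ≡ i
    φ≡id Fin.zero                = proj₁ φ-one-two
    φ≡id (Fin.suc Fin.zero)      = proj₂ φ-one-two
    φ≡id i@(Fin.suc (Fin.suc _)) = φ-fixed i (s≤s (s≤s z≤n))

    c-fixed : {i j : Fin N} {i<j : i Fin.< j} → CImage i j i<j → f (c i j i<j) ≡ c i j i<j
    c-fixed record { fc≡c = fc≡c ; x,y≈φi,φj = inj₁ (refl , refl) } =
      trans fc≡c (c-cong (φ≡id _) (φ≡id _))
    c-fixed {i<j = i<j} record { x<y = x<y ; x,y≈φi,φj = inj₂ (refl , refl) } =
      ⊥-elim (ℕₚ.<-asym i<j (subst₂ Fin._<_ (φ≡id _) (φ≡id _) x<y))

    f≡id : f p ≡ p → (x : Pt N) → f x ≡ x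
    f≡id fp≡p p         = fp≡p
    f≡id _    (a i)     = trans (f-a≡ i) (cong a (φ≡id i))
    f≡id _    (b i)     = trans (f-b≡ i) (cong b (φ≡id i))
    f≡id _    (c i j h) = c-fixed (c-image i j h)

  automorphism≡id : Surjective _≡_ _≡_ f → (x : Pt N) → f x ≡ x
  automorphism≡id surjective = f≡id φ (proj₁ ∘ proj₂ ∘ ab) (proj₂ ∘ proj₂ ∘ ab) fp≡p
    where
      fp≡p = f-p≡p surjective
      ab = ab-image fp≡p
      φ = proj₁ ∘ ab

corollary2p15 : (n : ℕ) → 3 < n → (f : Pt n → Pt n) → IsAutomorphism f →
    (x : Pt n) → f x ≡ x
corollary2p15 (suc (suc (suc (suc n′)))) _ f ((f-injective , f-surjective) , f-line) =
  automorphism≡id f f-injective (λ {x} {y} {z} → f-line x y z) f-surjective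
corollary2p15 0 ()
corollary2p15 1 (s≤s ())
corollary2p15 2 (s≤s (s≤s ()))
corollary2p15 3 (s≤s (s≤s (s≤s ())))
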